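{- For every integer $r\geq 1$, if $G$ is a connected $(P_3\cup rK_1)$-free graph, then $\rho^o(G)\leq 2r$.
   Context: All graphs are finite, simple and undirected. For $x\in V(G)$, $N(x)$ is the set of neighbours of $x$. A vertex subset $S$ of $G$ is an open packing if $N(x)\cap N(y)=\emptyset$ for every pair of distinct $x,y\in S$; $\rho^o(G)$ is the maximum size of an open packing. A graph is $H$-free if it has no induced subgraph isomorphic to $H$. $P_3$ is the path on three vertices, $rK_1$ the edgeless graph on $r$ vertices, and $\cup$ denotes disjoint union. -}

module Defs where

open import Data.Nat using (ℕ; zero; suc; _+_)
open import Data.Fin using (Fin; zero; suc)
open import Data.Fin.Subset using (Subset; _∈_)
open import Data.Product using (_×_; Σ; ∃)
open import Data.Empty using (⊥)
open import Relation.Nullary using (¬_; Dec)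
open import Relation.Binary.PropositionalEquality using (_≡_; _≢_)
open import Function.Definitions using (Injective)

record Graph : Set₁ where
  field
    n     : ℕ
    Adj   : Fin n → Fin n → Set
    adj?  : ∀ x y → Dec (Adj x y)
    sym   : ∀ {x y} → Adj x y → Adj y x
    irrefl : ∀ {x} → ¬ Adj x x
open Graph public

data Walk (G : Graph) : Fin (n G) → Fin (n G) → Set where
  here : ∀ {x} → Walk G x x
  step : ∀ {x y z} → Adj G x y → Walk G y z → Walk G x z

Connected : Graph → Set
Connected G = ∀ x y → Walk G x y

record InducedCopy (H G : Graph) : Set where
  field
    f     : Fin (n H) → Fin (n G)
    inj   : Injective _≡_ _≡_ f
    pres  : ∀ x y → Adj H x y → Adj G (f x) (f y)
    refl' : ∀ x y → Adj G (f x) (f y) → Adj H x y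

Free : Graph → Graph → Set
Free H G = ¬ InducedCopy H G

data P3Adj {r : ℕ} : Fin (3 + r) → Fin (3 + r) → Set where
  e01 : P3Adj zero (suc zero)
  e10 : P3Adj (suc zero) zero
  e12 : P3Adj (suc zero) (suc (suc zero))
  e21 : P3Adj (suc (suc zero)) (suc zero)

private
  p3adj? : ∀ {r} (x y : Fin (3 + r)) → Dec (P3Adj {r} x y)
  p3adj? zero zero = Relation.Nullary.no λ ()
  p3adj? zero (suc zero) = Relation.Nullary.yes e01
  p3adj? zero (suc (suc _)) = Relation.Nullary.no λ ()
  p3adj? (suc zero) zero = Relation.Nullary.yes e10
  p3adj? (suc zero) (suc zero) = Relation.Nullary.no λ ()
  p3adj? (suc zero) (suc (suc zero)) = Relation.Nullary.yes e12
  p3adj? (suc zero) (suc (suc (suc _))) = Relation.Nullary.no λ ()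
  p3adj? (suc (suc zero)) zero = Relation.Nullary.no λ ()
  p3adj? (suc (suc zero)) (suc zero) = Relation.Nullary.yes e21
  p3adj? (suc (suc zero)) (suc (suc _)) = Relation.Nullary.no λ ()
  p3adj? (suc (suc (suc _))) _ = Relation.Nullary.no λ ()

  p3sym : ∀ {r} {x y : Fin (3 + r)} → P3Adj {r} x y → P3Adj {r} y x
  p3sym e01 = e10
  p3sym e10 = e01
  p3sym e12 = e21
  p3sym e21 = e12

  p3irr : ∀ {r} {x : Fin (3 + r)} → ¬ P3Adj {r} x x
  p3irr ()

P3∪rK1 : ℕ → Graph
P3∪rK1 r = record
  { n = 3 + r ; Adj = P3Adj {r} ; adj? = p3adj? ; sym = p3sym ; irrefl = p3irr }

IsOpenPacking : (G : Graph) → Subset (n G) → Set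
IsOpenPacking G S =
  ∀ x y → x ∈ S → y ∈ S → x ≢ y → ∀ z → ¬ (Adj G x z × Adj G y z)

-- An open packing S induces a subgraph of maximum degree one (two members sharing a neighbour
-- would violate the packing), so any 2r − 1 of its members contain r independent ones.
-- Suppose |S| ≥ 2r + 1 ≥ 3. Connectivity yields an induced path P₃ disjoint from and
-- anticomplete to all members of S but two: if S contains an edge xy, a neighbour w ∉ {x, y}
-- of it gives w – x – y, excluding x and y; if S is independent, a walk from x ∈ S leaving
-- N[x] gives x – u – w, excluding x and the at most one member of S in N[w]. The P₃ and
-- r independent members of the remaining 2r − 1 induce P₃ ∪ rK₁.

module Submission where

open import Defs
open import Data.Nat using (ℕ; _≤_; _*_)
open import Data.Fin.Subset using (Subset; ∣_∣)

open import Level using (Level)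
open import Data.Nat.Base using (zero; suc; _+_; _<_; z≤n; s≤s; s≤s⁻¹)
open import Data.Nat.Properties
  using ( module ≤-Reasoning; ≤-reflexive; ≤-trans; ≤-<-trans; <-irrefl; ≮⇒≥
        ; +-suc; +-identityʳ; +-mono-≤; m≤n+m; n≤1+n)
open import Data.Fin.Base using (Fin; zero; suc)
open import Data.Fin.Properties using (_≟_; any?)
open import Data.Fin.Subset using (_∈_; _⊆_; _─_; _-_; ⁅_⁆; Nonempty; inside; outside)
open import Data.Fin.Subset.Properties
  using (_∈?_; nonempty?; Empty-unique; ∣⊥∣≡0; ∣⁅x⁆∣≡1; x∉⁅y⁆⇒x≢y; p─q⊆p)
open import Data.Vec.Base as Vec using ([]; here; there)
open import Data.Vec.Functional using (_∷_)
open import Data.Product using (∃; ∃₂; _×_; _,_; proj₁; proj₂)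
open import Data.Sum using (_⊎_; inj₁; inj₂; [_,_])
open import Data.Empty using (⊥-elim)
open import Function using (_∘_)
open import Function.Definitions using (Injective)
open import Relation.Nullary using (¬_; yes; no)
open import Relation.Nullary.Decidable using (_×-dec_; _⊎-dec_; decidable-stable)
open import Relation.Unary using (Pred; Decidable)
open import Relation.Binary.PropositionalEquality as ≡ using (_≡_; _≢_; refl; cong)

private
  variable
    ℓ ℓ′ : Level
    A : Set ℓ′
    m : ℕ

x∈p─q⇒x∉q : ∀ {x} (p q : Subset m) → x ∈ p ─ q → ¬ x ∈ q
x∈p─q⇒x∉q (inside Vec.∷ p) (outside Vec.∷ q) here      ()
x∈p─q⇒x∉q (_      Vec.∷ p) (_       Vec.∷ q) (there x∈) (there x∈q) = x∈p─q⇒x∉q p q x∈ x∈q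

∣p∣≤∣q∣+∣p─q∣ : ∀ (p q : Subset m) → ∣ p ∣ ≤ ∣ q ∣ + ∣ p ─ q ∣
∣p∣≤∣q∣+∣p─q∣ []                []                = z≤n
∣p∣≤∣q∣+∣p─q∣ (inside  Vec.∷ p) (inside  Vec.∷ q) = s≤s (∣p∣≤∣q∣+∣p─q∣ p q)
∣p∣≤∣q∣+∣p─q∣ (outside Vec.∷ p) (inside  Vec.∷ q) = ≤-trans (∣p∣≤∣q∣+∣p─q∣ p q) (n≤1+n _)
∣p∣≤∣q∣+∣p─q∣ (outside Vec.∷ p) (outside Vec.∷ q) = ∣p∣≤∣q∣+∣p─q∣ p q
∣p∣≤∣q∣+∣p─q∣ (inside  Vec.∷ p) (outside Vec.∷ q) =
  ≤-trans (s≤s (∣p∣≤∣q∣+∣p─q∣ p q)) (≤-reflexive (≡.sym (+-suc ∣ q ∣ ∣ p ─ q ∣)))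

∣p∣≤1+∣p-x∣ : ∀ (p : Subset m) x → ∣ p ∣ ≤ suc ∣ p - x ∣
∣p∣≤1+∣p-x∣ p x = ≤-trans (∣p∣≤∣q∣+∣p─q∣ p ⁅ x ⁆) (≤-reflexive (cong (_+ ∣ p - x ∣) (∣⁅x⁆∣≡1 x)))

∣p∣≤2+∣p-x-y∣ : ∀ (p : Subset m) x y → ∣ p ∣ ≤ 2 + ∣ p - x - y ∣
∣p∣≤2+∣p-x-y∣ p x y = ≤-trans (∣p∣≤1+∣p-x∣ p x) (s≤s (∣p∣≤1+∣p-x∣ (p - x) y))

∈p-x⁻ : ∀ {p : Subset m} {x z} → z ∈ p - x → z ∈ p × z ≢ x
∈p-x⁻ {p = p} {x} z∈p-x = p─q⊆p p ⁅ x ⁆ z∈p-x , x∉⁅y⁆⇒x≢y (x∈p─q⇒x∉q p ⁅ x ⁆ z∈p-x)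

∈p-x-y⁻ : ∀ {p : Subset m} {x y z} → z ∈ p - x - y → z ∈ p × z ≢ x × z ≢ y
∈p-x-y⁻ z∈p-x-y with ∈p-x⁻ z∈p-x-y
... | z∈p-x , z≢y with ∈p-x⁻ z∈p-x
...   | z∈p , z≢x = z∈p , z≢x , z≢y

p-x-y⊆p : ∀ {p : Subset m} {x y} → p - x - y ⊆ p
p-x-y⊆p = proj₁ ∘ ∈p-x-y⁻

0<∣p∣⇒Nonempty : ∀ {p : Subset m} → 0 < ∣ p ∣ → Nonempty p
0<∣p∣⇒Nonempty {m} {p} 0<∣p∣ = decidable-stable (nonempty? p) λ empty →
  <-irrefl (≡.sym (≡.trans (cong ∣_∣ (Empty-unique empty)) (∣⊥∣≡0 m))) 0<∣p∣

∈-avoiding : ∀ {p : Subset m} x y → 2 < ∣ p ∣ → ∃ λ z → z ∈ p × z ≢ x × z ≢ y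
∈-avoiding {p = p} x y 2<∣p∣ with 0<∣p∣⇒Nonempty (s≤s⁻¹ (s≤s⁻¹ (≤-trans 2<∣p∣ (∣p∣≤2+∣p-x-y∣ p x y))))
... | z , z∈p-x-y = z , ∈p-x-y⁻ z∈p-x-y

∷-injective : ∀ {x : A} {g : Fin m → A} → Injective _≡_ _≡_ g → (∀ i → g i ≢ x) →
              Injective _≡_ _≡_ (x ∷ g)
∷-injective g-inj g≢x {zero}  {zero}  _      = refl
∷-injective g-inj g≢x {zero}  {suc j} x≡gj  = ⊥-elim (g≢x j (≡.sym x≡gj))
∷-injective g-inj g≢x {suc i} {zero}  gi≡x  = ⊥-elim (g≢x i gi≡x)
∷-injective g-inj g≢x {suc i} {suc j} gi≡gj = cong suc (g-inj gi≡gj)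

AtMostOne : Pred A ℓ → Set _
AtMostOne P = ∀ {y z} → P y → P z → y ≡ z

atMostOne⇒⊆-singleton : ∀ {P : Pred (Fin m) ℓ} → Fin m → Decidable P → AtMostOne P →
                        ∃ λ k → ∀ {z} → P z → z ≡ k
atMostOne⇒⊆-singleton default P? unique with any? P?
... | yes (k , Pk) = k , λ Pz → unique Pz Pk
... | no ¬∃P       = default , λ {z} Pz → ⊥-elim (¬∃P (z , Pz))

module _ (G : Graph) where

  private
    V : Set
    V = Fin (n G)

    _~_ : V → V → Set
    _~_ = Adj G

    ~⇒≢ : ∀ {x y} → x ~ y → x ≢ y
    ~⇒≢ x~y refl = irrefl G x~y

  walk-exits : ∀ {P : Pred V ℓ} → Decidable P → ∀ {x y} → Walk G x y → P x → ¬ P y →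
               ∃₂ λ u w → P u × ¬ P w × u ~ w
  walk-exits P? here                    Px ¬Py = ⊥-elim (¬Py Px)
  walk-exits P? (step {y = v} x~v walk) Px ¬Py with P? v
  ... | yes Pv = walk-exits P? walk Pv ¬Py
  ... | no ¬Pv = _ , v , Px , ¬Pv , x~v

  IsIndependent : Subset (n G) → Set
  IsIndependent S = ∀ {x y} → x ∈ S → y ∈ S → ¬ x ~ y

  AtMostOneNeighbourIn : Subset (n G) → Set
  AtMostOneNeighbourIn T = ∀ x → ∃ λ k → ∀ {z} → z ∈ T → x ~ z → z ≡ k

  atMostOneNeighbourIn-⊆ : ∀ {T U} → T ⊆ U → AtMostOneNeighbourIn U → AtMostOneNeighbourIn T
  atMostOneNeighbourIn-⊆ T⊆U sparse x = let (k , unique) = sparse x in k , unique ∘ T⊆U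

  record IndependentFamily (T : Subset (n G)) (r : ℕ) : Set where
    field
      member      : Fin r → V
      injective   : Injective _≡_ _≡_ member
      independent : ∀ i j → ¬ member i ~ member j
      member∈T    : ∀ i → member i ∈ T

  -- Greedily keep some x ∈ T and discard x together with its only possible neighbour k in T.
  independentFamily : ∀ {T} → AtMostOneNeighbourIn T → ∀ r → r + r ≤ suc ∣ T ∣ →
                      IndependentFamily T r
  independentFamily _ zero _ = record
    { member = λ () ; injective = λ { {()} } ; independent = λ () ; member∈T = λ () }
  independentFamily {T} sparse (suc r) bound
    with 0<∣p∣⇒Nonempty (≤-trans (s≤s z≤n) (≤-trans (m≤n+m (suc r) r) (s≤s⁻¹ bound)))
  ... | x , x∈T with sparse x
  ... | k , neighbour≡k = record
    { member      = x ∷ F.member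
    ; injective   = ∷-injective F.injective (proj₁ ∘ proj₂ ∘ member∈T′⁻)
    ; independent = independent
    ; member∈T    = λ { zero → x∈T ; (suc i) → proj₁ (member∈T′⁻ i) }
    }
    where
    T′ = T - x - k
    open ≤-Reasoning
    bound′ : r + r ≤ suc ∣ T′ ∣
    bound′ = s≤s⁻¹ (s≤s⁻¹ (begin
      suc (suc (r + r)) ≡⟨ cong suc (+-suc r r) ⟨
      suc r + suc r     ≤⟨ bound ⟩
      suc ∣ T ∣          ≤⟨ s≤s (∣p∣≤2+∣p-x-y∣ T x k) ⟩
      3 + ∣ T′ ∣         ∎))
    module F = IndependentFamily
      (independentFamily {T′} (atMostOneNeighbourIn-⊆ (p-x-y⊆p {p = T}) sparse) r bound′)
    member∈T′⁻ : ∀ i → F.member i ∈ T × F.member i ≢ x × F.member i ≢ k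
    member∈T′⁻ i = ∈p-x-y⁻ (F.member∈T i)
    x≁member : ∀ i → ¬ x ~ F.member i
    x≁member i x~member =
      let (member∈T , _ , member≢k) = member∈T′⁻ i in member≢k (neighbour≡k member∈T x~member)
    independent : ∀ i j → ¬ (x ∷ F.member) i ~ (x ∷ F.member) j
    independent zero    zero    = irrefl G
    independent zero    (suc j) = x≁member j
    independent (suc i) zero    = x≁member i ∘ sym G
    independent (suc i) (suc j) = F.independent i j

  record Remote (a b c v : V) : Set where
    field
      ≢a : v ≢ a
      ≢b : v ≢ b
      ≢c : v ≢ c
      ≁a : ¬ v ~ a
      ≁b : ¬ v ~ b
      ≁c : ¬ v ~ c
  open Remote

  record RemoteP₃ (S : Subset (n G)) : Set where
    field
      a b c k₁ k₂ : V
      a~b    : a ~ b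
      b~c    : b ~ c
      a≁c    : ¬ a ~ c
      a≢c    : a ≢ c
      remote : ∀ {v} → v ∈ S → v ≢ k₁ → v ≢ k₂ → Remote a b c v

  inducedP₃∪rK₁ : ∀ {a b c T r} → a ~ b → b ~ c → ¬ a ~ c → a ≢ c → (F : IndependentFamily T r) →
                (∀ i → Remote a b c (IndependentFamily.member F i)) → InducedCopy (P3∪rK1 r) G
  inducedP₃∪rK₁ {a} {b} {c} a~b b~c a≁c a≢c F remote = record
    { f = f ; inj = injective ; pres = preserves ; refl' = reflects }
    where
    module F = IndependentFamily F
    f : Fin (3 + _) → V
    f = a ∷ b ∷ c ∷ F.member

    injective : Injective _≡_ _≡_ f
    injective =
      ∷-injective (∷-injective (∷-injective F.injective (≢c ∘ remote)) c∷member≢b) b∷c∷member≢a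
      where
      c∷member≢b : ∀ i → (c ∷ F.member) i ≢ b
      c∷member≢b zero    = ~⇒≢ b~c ∘ ≡.sym
      c∷member≢b (suc i) = ≢b (remote i)
      b∷c∷member≢a : ∀ i → (b ∷ c ∷ F.member) i ≢ a
      b∷c∷member≢a zero          = ~⇒≢ a~b ∘ ≡.sym
      b∷c∷member≢a (suc zero)    = a≢c ∘ ≡.sym
      b∷c∷member≢a (suc (suc i)) = ≢a (remote i)

    preserves : ∀ x y → Adj (P3∪rK1 _) x y → f x ~ f y
    preserves _ _ e01 = a~b
    preserves _ _ e10 = sym G a~b
    preserves _ _ e12 = b~c
    preserves _ _ e21 = sym G b~c

    isolated : ∀ i y → ¬ F.member i ~ f y
    isolated i zero                = ≁a (remote i)
    isolated i (suc zero)          = ≁b (remote i)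
    isolated i (suc (suc zero))    = ≁c (remote i)
    isolated i (suc (suc (suc j))) = F.independent i j

    reflects : ∀ x y → f x ~ f y → Adj (P3∪rK1 _) x y
    reflects zero             (suc zero)       _   = e01
    reflects (suc zero)       zero             _   = e10
    reflects (suc zero)       (suc (suc zero)) _   = e12
    reflects (suc (suc zero)) (suc zero)       _   = e21
    reflects zero             zero             a~a = ⊥-elim (irrefl G a~a)
    reflects (suc zero)       (suc zero)       b~b = ⊥-elim (irrefl G b~b)
    reflects (suc (suc zero)) (suc (suc zero)) c~c = ⊥-elim (irrefl G c~c)
    reflects zero             (suc (suc zero)) a~c = ⊥-elim (a≁c a~c)
    reflects (suc (suc zero)) zero             c~a = ⊥-elim (a≁c (sym G c~a))
    reflects (suc (suc (suc i))) y             i~y = ⊥-elim (isolated i y i~y)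
    reflects x             (suc (suc (suc j))) x~j = ⊥-elim (isolated j x (sym G x~j))

  remoteP₃⇒inducedCopy : ∀ {S r} → AtMostOneNeighbourIn S → RemoteP₃ S → r + r < ∣ S ∣ →
                         InducedCopy (P3∪rK1 r) G
  remoteP₃⇒inducedCopy {S} {r} sparse P bound =
    inducedP₃∪rK₁ a~b b~c a≁c a≢c F member-remote
    where
    open RemoteP₃ P
    F : IndependentFamily (S - k₁ - k₂) r
    F = independentFamily (atMostOneNeighbourIn-⊆ (p-x-y⊆p {p = S}) sparse) r
          (s≤s⁻¹ (≤-trans bound (∣p∣≤2+∣p-x-y∣ S k₁ k₂)))
    member-remote : ∀ i → Remote a b c (IndependentFamily.member F i)
    member-remote i =
      let (v∈S , v≢k₁ , v≢k₂) = ∈p-x-y⁻ (IndependentFamily.member∈T F i) in remote v∈S v≢k₁ v≢k₂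

  module _ {S : Subset (n G)} (packing : IsOpenPacking G S) where

    common-neighbour⇒≡ : ∀ {x y z} → y ∈ S → z ∈ S → y ~ x → z ~ x → y ≡ z
    common-neighbour⇒≡ {x} {y} {z} y∈S z∈S y~x z~x =
      decidable-stable (y ≟ z) λ y≢z → packing y z y∈S z∈S y≢z x (y~x , z~x)

    packing⇒atMostOneNeighbourIn : AtMostOneNeighbourIn S
    packing⇒atMostOneNeighbourIn x =
      let (k , unique) = atMostOne⇒⊆-singleton x (λ z → z ∈? S ×-dec adj? G x z)
                           λ (y∈S , x~y) (z∈S , x~z) → common-neighbour⇒≡ y∈S z∈S (sym G x~y) (sym G x~z)
      in k , λ z∈S x~z → unique (z∈S , x~z)

    remoteP₃-at-edge : ∀ {x y w} → x ∈ S → y ∈ S → x ~ y → w ~ x → w ≢ x → w ≢ y → RemoteP₃ S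
    remoteP₃-at-edge {x} {y} {w} x∈S y∈S x~y w~x w≢x w≢y = record
      { a = w ; b = x ; c = y ; k₁ = x ; k₂ = y
      ; a~b = w~x ; b~c = x~y ; a≁c = w≁y ; a≢c = w≢y
      ; remote = λ {v} v∈S v≢x v≢y → record
        { ≢a = λ { refl → w≢y (common-neighbour⇒≡ v∈S y∈S w~x (sym G x~y)) }
        ; ≢b = v≢x
        ; ≢c = v≢y
        ; ≁a = λ v~w → v≢x (common-neighbour⇒≡ v∈S x∈S v~w (sym G w~x))
        ; ≁b = λ v~x → v≢y (common-neighbour⇒≡ v∈S y∈S v~x (sym G x~y))
        ; ≁c = λ v~y → v≢x (common-neighbour⇒≡ v∈S x∈S v~y x~y)
        }
      }
      where
      w≁y : ¬ w ~ y
      w≁y w~y = ~⇒≢ x~y (common-neighbour⇒≡ x∈S y∈S (sym G w~x) (sym G w~y))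

    remoteP₃-at-independent : IsIndependent S → ∀ {x u w} → x ∈ S → x ~ u → u ~ w → w ≢ x → ¬ x ~ w →
                              RemoteP₃ S
    remoteP₃-at-independent independent {x} {u} {w} x∈S x~u u~w w≢x x≁w = record
      { a = x ; b = u ; c = w ; k₁ = x ; k₂ = k
      ; a~b = x~u ; b~c = u~w ; a≁c = x≁w ; a≢c = w≢x ∘ ≡.sym
      ; remote = λ {v} v∈S v≢x v≢k → record
        { ≢a = v≢x
        ; ≢b = λ { refl → independent x∈S v∈S x~u }
        ; ≢c = λ v≡w → v≢k (near⇒≡k (v∈S , inj₁ v≡w))
        ; ≁a = independent v∈S x∈S
        ; ≁b = λ v~u → v≢x (common-neighbour⇒≡ v∈S x∈S v~u x~u)
        ; ≁c = λ v~w → v≢k (near⇒≡k (v∈S , inj₂ v~w))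
        }
      }
      where
      Near : V → Set
      Near v = v ∈ S × (v ≡ w ⊎ v ~ w)
      atMostOneNear : AtMostOne Near
      atMostOneNear (_   , inj₁ refl) (_   , inj₁ refl) = refl
      atMostOneNear (w∈S , inj₁ refl) (z∈S , inj₂ z~w)  = ⊥-elim (independent z∈S w∈S z~w)
      atMostOneNear (y∈S , inj₂ y~w)  (w∈S , inj₁ refl) = ⊥-elim (independent y∈S w∈S y~w)
      atMostOneNear (y∈S , inj₂ y~w)  (z∈S , inj₂ z~w)  = common-neighbour⇒≡ y∈S z∈S y~w z~w
      near :  ∃ λ k → ∀ {v} → Near v → v ≡ k
      near = atMostOne⇒⊆-singleton x (λ v → v ∈? S ×-dec (v ≟ w ⊎-dec adj? G v w)) atMostOneNear
      k = proj₁ near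
      near⇒≡k = proj₂ near

    remoteP₃-around-edge : Connected G → 2 < ∣ S ∣ → ∀ {x y} → x ∈ S → y ∈ S → x ~ y → RemoteP₃ S
    remoteP₃-around-edge connected 2<∣S∣ {x} {y} x∈S y∈S x~y with ∈-avoiding {p = S} x y 2<∣S∣
    ... | s , _ , s≢x , s≢y
      with walk-exits (λ v → v ≟ x ⊎-dec v ≟ y) (connected x s) (inj₁ refl) [ s≢x , s≢y ]
    ...   | _ , w , inj₁ refl , w∉ , x~w =
            remoteP₃-at-edge x∈S y∈S x~y (sym G x~w) (w∉ ∘ inj₁) (w∉ ∘ inj₂)
    ...   | _ , w , inj₂ refl , w∉ , y~w =
            remoteP₃-at-edge y∈S x∈S (sym G x~y) (sym G y~w) (w∉ ∘ inj₂) (w∉ ∘ inj₁)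

    remoteP₃-of-independent : Connected G → 2 < ∣ S ∣ → IsIndependent S → RemoteP₃ S
    remoteP₃-of-independent connected 2<∣S∣ independent
      with 0<∣p∣⇒Nonempty {p = S} (≤-trans (s≤s z≤n) 2<∣S∣)
    ... | x , x∈S with ∈-avoiding {p = S} x x 2<∣S∣
    ...   | s , s∈S , s≢x , _
      with walk-exits (λ v → v ≟ x ⊎-dec adj? G x v) (connected x s) (inj₁ refl)
             [ s≢x , independent x∈S s∈S ]
    ...     | _ , w , inj₁ refl , w∉ , x~w = ⊥-elim (w∉ (inj₂ x~w))
    ...     | u , w , inj₂ x~u  , w∉ , u~w =
              remoteP₃-at-independent independent x∈S x~u u~w (w∉ ∘ inj₁) (w∉ ∘ inj₂)

    remoteP₃ : Connected G → 2 < ∣ S ∣ → RemoteP₃ S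
    remoteP₃ connected 2<∣S∣
      with any? (λ x → any? λ y → x ∈? S ×-dec y ∈? S ×-dec adj? G x y)
    ... | yes (_ , _ , x∈S , y∈S , x~y) = remoteP₃-around-edge connected 2<∣S∣ x∈S y∈S x~y
    ... | no noEdge = remoteP₃-of-independent connected 2<∣S∣
                        λ x∈S y∈S x~y → noEdge (_ , _ , x∈S , y∈S , x~y)

lemma10 : (r : ℕ) → 1 ≤ r → (G : Graph) → Connected G → Free (P3∪rK1 r) G →
    (S : Subset (n G)) → IsOpenPacking G S → ∣ S ∣ ≤ 2 * r
lemma10 r 1≤r G connected free S packing = ≮⇒≥ λ 2r<∣S∣ →
  let r+r<∣S∣ = ≡.subst (λ k → r + k < ∣ S ∣) (+-identityʳ r) 2r<∣S∣
      2<∣S∣   = ≤-<-trans (+-mono-≤ 1≤r 1≤r) r+r<∣S∣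
  in free (remoteP₃⇒inducedCopy G (packing⇒atMostOneNeighbourIn G packing)
             (remoteP₃ G packing connected 2<∣S∣) r+r<∣S∣)
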